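{- Let $G = \prod_{i=1}^t K[a_i,b_i]$, where $2 \leq b_1 \leq \cdots \leq b_t$. Let $S$ be an irredundant set in $G$, and let $T \subseteq \mathrm{pn}[S]$ be chosen so that each vertex of $S$ has exactly one private neighbor in $T$. If there exist three vertices $v_1,v_2,v_3 \in T$ such that the vectors $p(v_1),p(v_2),p(v_3)$ agree in all coordinates except exactly one, in which they are pairwise distinct, then $v_1,v_2,v_3$ are lonely vertices of $S$.
   Context: $K[a,b]$ is the balanced complete $b$-partite graph with parts of size $a$. Label the vertices of $K[a_i,b_i]$ by $\mathbb{Z}/a_ib_i\mathbb{Z}$, two vertices being adjacent iff they are not congruent modulo $b_i$. The direct product $\prod_i G_i$ has tuples as vertices, adjacent iff adjacent in every coordinate. For $v\in V(G)$ write $v=(v(1),\dots,v(t))$ with $v(i)\in\{0,\dots,a_ib_i-1\}$ and $p(v)=(v(1)\bmod b_1,\dots,v(t)\bmod b_t)$; so $u,v$ are adjacent iff $p(u)$ and $p(v)$ differ in every coordinate. For $S\subseteq V(G)$ and $v\in S$, $\mathrm{pn}[v;S]=N[v]\setminus N[S\setminus\{v\}]$ is the set of private neighbors of $v$ (closed neighborhoods; $v$ itself may be one), $\mathrm{pn}[S]=\bigcup_{v\in S}\mathrm{pn}[v;S]$, and $S$ is irredundant if $\mathrm{pn}[v;S]\ne\emptyset$ for all $v\in S$. A vertex $v\in S$ is lonely if it is isolated in the induced subgraph $G[S]$; "$v$ is a lonely vertex of $S$" means $v\in S$ and $v$ is lonely. -}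

module Defs where

open import Data.Nat using (ℕ; zero; suc; _≤_; _<_; _*_; _%_)
open import Data.Fin using (Fin)
open import Data.Vec using (Vec; lookup)
open import Data.Bool using (Bool; true)
open import Data.Product using (Σ; ∃; _×_)
open import Data.Sum using (_⊎_)
open import Relation.Nullary using (¬_)
open import Relation.Binary.PropositionalEquality using (_≡_; _≢_)

-- m mod n (convention: m mod 0 = m; only used with n ≥ 2, where it is the usual remainder)
modN : ℕ → ℕ → ℕ
modN m zero = m
modN m (suc n) = m % suc n

-- The product graph G = ∏_{i<t} K[a i , b i]; vertices are vectors v ∈ ℕ^t
-- with v(i) < a i * b i (i.e. v(i) ∈ ℤ/(a i b i)).
module ProductGraph (t : ℕ) (a b : Fin t → ℕ) where

  Vertex : Set
  Vertex = Vec ℕ t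

  Valid : Vertex → Set
  Valid v = (i : Fin t) → lookup v i < a i * b i

  p : Vertex → Fin t → ℕ
  p v i = modN (lookup v i) (b i)

  Adj : Vertex → Vertex → Set
  Adj u v = (i : Fin t) → p u i ≢ p v i

  VSet : Set
  VSet = Vertex → Bool

  _∈S_ : Vertex → VSet → Set
  v ∈S S = S v ≡ true

  ClosedNbr : Vertex → Vertex → Set
  ClosedNbr v w = Valid w × (w ≡ v ⊎ Adj v w)

  PrivNbr : VSet → Vertex → Vertex → Set
  PrivNbr S v w = ClosedNbr v w × ¬ (∃ λ s → s ∈S S × s ≢ v × ClosedNbr s w)

  InPn : VSet → Vertex → Set
  InPn S w = ∃ λ v → v ∈S S × PrivNbr S v w

  Irredundant : VSet → Set
  Irredundant S = ((v : Vertex) → v ∈S S → Valid v)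
                × ((v : Vertex) → v ∈S S → ∃ λ w → PrivNbr S v w)

  ExactlyOnePrivIn : VSet → VSet → Set
  ExactlyOnePrivIn S T = (v : Vertex) → v ∈S S →
    ∃ λ w → (w ∈S T × PrivNbr S v w) ×
            ((w' : Vertex) → w' ∈S T → PrivNbr S v w' → w' ≡ w)

  Lonely : VSet → Vertex → Set
  Lonely S v = v ∈S S × ((u : Vertex) → u ∈S S → ¬ Adj v u)

  AgreeExceptOne : Vertex → Vertex → Vertex → Set
  AgreeExceptOne v₁ v₂ v₃ = ∃ λ (j : Fin t) →
    ((i : Fin t) → i ≢ j → p v₁ i ≡ p v₂ i × p v₂ i ≡ p v₃ i)
    × p v₁ j ≢ p v₂ j × p v₁ j ≢ p v₃ j × p v₂ j ≢ p v₃ j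

module Submission where

-- Every w ∈ T is a private neighbour of some owner
-- s ∈ S, and distinct vertices of T have distinct owners (each vertex of
-- S has exactly one private neighbour in T).  A private neighbour of s is
-- not adjacent to any other vertex of S.  Now let x, y, z ∈ T have
-- p-vectors agreeing off one coordinate j and pairwise different at j.
-- If the owner s of x were a neighbour of x (rather than x itself), then s
-- is not adjacent to y nor to z; since y and z differ from x only at j,
-- this forces p(s)(j) = p(y)(j) and p(s)(j) = p(z)(j), contradicting
-- p(y)(j) ≠ p(z)(j).  Hence x is its own owner, i.e. x ∈ S and x ∈ pn[x;S],
-- and a vertex of S that is its own private neighbour is lonely.

open import Defs
open import Data.Nat using (ℕ; _≤_)
open import Data.Fin using (Fin) renaming (_≤_ to _≤ᶠ_)
open import Data.Product using (_×_; _,_; proj₁; proj₂)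
open import Data.Sum using (inj₁; inj₂)
open import Data.Empty using (⊥-elim)
open import Relation.Nullary using (¬_; yes; no)
open import Relation.Binary.PropositionalEquality
  using (_≡_; _≢_; refl; sym; trans; cong; subst; ≢-sym)
import Data.Nat as ℕ
import Data.Fin as Fin

module Irredundance (t : ℕ) (a b : Fin t → ℕ) where
  open ProductGraph t a b

  AgreeOff : Fin t → Vertex → Vertex → Set
  AgreeOff j u v = (i : Fin t) → i ≢ j → p u i ≡ p v i

  -- Agreement off j is an equivalence relation; symmetry and transitivity
  -- let one hypothesis AgreeExceptOne serve all three vertices.
  agreeOff-sym : ∀ {j} u v → AgreeOff j u v → AgreeOff j v u
  agreeOff-sym u v ag i i≢j = sym (ag i i≢j)

  agreeOff-trans : ∀ {j} u v w → AgreeOff j u v → AgreeOff j v w → AgreeOff j u w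
  agreeOff-trans u v w ag ag' i i≢j = trans (ag i i≢j) (ag' i i≢j)

  adj-sym : ∀ u v → Adj u v → Adj v u
  adj-sym u v ad i e = ad i (sym e)

  adj-irrefl : Fin t → ∀ u → ¬ Adj u u
  adj-irrefl j u ad = ad j refl

  private-notAdj : ∀ {S s} s' w → PrivNbr S s w → s' ∈S S → s' ≢ s → ¬ Adj s' w
  private-notAdj s' w (nbr , notDominated) s'∈S s'≢s ad =
    notDominated (s' , s'∈S , s'≢s , proj₁ nbr , inj₂ ad)

  owner-injective : ∀ {S T s s' w w'} → ExactlyOnePrivIn S T → s ∈S S →
    w ∈S T → PrivNbr S s w → w' ∈S T → PrivNbr S s' w' → s ≡ s' → w ≡ w'
  owner-injective {S} {T} {s} ex s∈S w∈T pw w'∈T pw' refl =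
    trans (unique _ w∈T pw) (sym (unique _ w'∈T pw'))
    where
    unique : (u : Vertex) → u ∈S T → PrivNbr S s u → u ≡ proj₁ (ex s s∈S)
    unique = proj₂ (proj₂ (ex s s∈S))

  agreeOff-nonAdj : ∀ {j} u x w → Adj u x → AgreeOff j x w → ¬ Adj u w →
    p u j ≡ p w j
  agreeOff-nonAdj {j} u x w ad ag nonAdj with p u j ℕ.≟ p w j
  ... | yes e = e
  ... | no ne = ⊥-elim (nonAdj adj-uw)
    where
    adj-uw : Adj u w
    adj-uw i with i Fin.≟ j
    ... | yes refl = ne
    ... | no i≢j = λ e → ad i (trans e (sym (ag i i≢j)))

  -- Main step: the owner s of x is x itself.  Otherwise s is a neighbour
  -- of x but (having different owners) not of y and z, so p(y)(j) and
  -- p(z)(j) both equal p(s)(j).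
  owner-is-self : ∀ {S T s sy sz x y z j} → ExactlyOnePrivIn S T →
    s ∈S S → sy ∈S S → sz ∈S S →
    x ∈S T → y ∈S T → z ∈S T →
    PrivNbr S s x → PrivNbr S sy y → PrivNbr S sz z →
    AgreeOff j x y → AgreeOff j x z →
    p x j ≢ p y j → p x j ≢ p z j → p y j ≢ p z j → s ≡ x
  owner-is-self {s = s} {sy} {sz} {x} {y} {z} {j}
    ex s∈S sy∈S sz∈S x∈T y∈T z∈T px py pz agy agz dxy dxz dyz with proj₂ (proj₁ px)
  ... | inj₁ x≡s = sym x≡s
  ... | inj₂ adj-sx = ⊥-elim (dyz (trans (sym s-y) s-z))
    where
    s≢sy : s ≢ sy
    s≢sy s≡sy = dxy (cong (λ v → p v j) (owner-injective ex s∈S x∈T px y∈T py s≡sy))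
    s≢sz : s ≢ sz
    s≢sz s≡sz = dxz (cong (λ v → p v j) (owner-injective ex s∈S x∈T px z∈T pz s≡sz))
    s-y : p s j ≡ p y j
    s-y = agreeOff-nonAdj s x y adj-sx agy (private-notAdj s y py s∈S s≢sy)
    s-z : p s j ≡ p z j
    s-z = agreeOff-nonAdj s x z adj-sx agz (private-notAdj s z pz s∈S s≢sz)

  -- A vertex of S that is its own private neighbour is lonely: a neighbour
  -- u ∈ S of x is different from x and would dominate x.
  selfPrivate-lonely : Fin t → ∀ {S x} → x ∈S S → PrivNbr S x x → Lonely S x
  selfPrivate-lonely j {S} {x} x∈S px = x∈S , noNeighbour
    where
    noNeighbour : (u : Vertex) → u ∈S S → ¬ Adj x u
    noNeighbour u u∈S ad = private-notAdj u x px u∈S u≢x (adj-sym x u ad)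
      where
      u≢x : u ≢ x
      u≢x refl = adj-irrefl j x ad

  triple-lonely : ∀ {S T j} x y z →
    ((w : Vertex) → w ∈S T → InPn S w) → ExactlyOnePrivIn S T →
    x ∈S T → y ∈S T → z ∈S T → AgreeOff j x y → AgreeOff j x z →
    p x j ≢ p y j → p x j ≢ p z j → p y j ≢ p z j → Lonely S x
  triple-lonely {S} {j = j} x y z inPn ex x∈T y∈T z∈T agy agz dxy dxz dyz
    with inPn x x∈T | inPn y y∈T | inPn z z∈T
  ... | s , s∈S , px | _ , sy∈S , py | _ , sz∈S , pz =
    selfPrivate-lonely j (subst (_∈S S) s≡x s∈S) (subst (λ v → PrivNbr S v x) s≡x px)
    where
    s≡x : s ≡ x
    s≡x = owner-is-self {x = x} {y} {z}
      ex s∈S sy∈S sz∈S x∈T y∈T z∈T px py pz agy agz dxy dxz dyz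

lemma5p2 : (t : ℕ) (a b : Fin t → ℕ) →
    ((i : Fin t) → 1 ≤ a i) →
    ((i : Fin t) → 2 ≤ b i) →
    ((i j : Fin t) → i ≤ᶠ j → b i ≤ b j) →
    let open ProductGraph t a b in
    (S T : VSet) →
    Irredundant S →
    ((w : Vertex) → w ∈S T → InPn S w) →
    ExactlyOnePrivIn S T →
    (v₁ v₂ v₃ : Vertex) → v₁ ∈S T → v₂ ∈S T → v₃ ∈S T →
    AgreeExceptOne v₁ v₂ v₃ →
    Lonely S v₁ × Lonely S v₂ × Lonely S v₃
lemma5p2 t a b _ _ _ S T _ inPn ex v₁ v₂ v₃ v₁∈T v₂∈T v₃∈T (j , agree , d₁₂ , d₁₃ , d₂₃) =
    triple-lonely v₁ v₂ v₃ inPn ex v₁∈T v₂∈T v₃∈T ag₁₂ ag₁₃ d₁₂ d₁₃ d₂₃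
  , triple-lonely v₂ v₁ v₃ inPn ex v₂∈T v₁∈T v₃∈T (agreeOff-sym v₁ v₂ ag₁₂) ag₂₃ (≢-sym d₁₂) d₂₃ d₁₃
  , triple-lonely v₃ v₁ v₂ inPn ex v₃∈T v₁∈T v₂∈T (agreeOff-sym v₁ v₃ ag₁₃) (agreeOff-sym v₂ v₃ ag₂₃) (≢-sym d₁₃) (≢-sym d₂₃) d₁₂
  where
  open Irredundance t a b

  ag₁₂ : AgreeOff j v₁ v₂
  ag₁₂ i i≢j = proj₁ (agree i i≢j)
  ag₂₃ : AgreeOff j v₂ v₃
  ag₂₃ i i≢j = proj₂ (agree i i≢j)
  ag₁₃ : AgreeOff j v₁ v₃
  ag₁₃ = agreeOff-trans v₁ v₂ v₃ ag₁₂ ag₂₃
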